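{- Let $\kappa_{\mathrm{up}},\kappa_{\mathrm{dn}}$ be infinite regular cardinals and let $(\bar\eta^{\mathrm{up}},\bar\eta^{\mathrm{dn}})$, where $\bar\eta^{\mathrm{up}} = \langle \eta^{\mathrm{up}}_\alpha : \alpha<\kappa_{\mathrm{up}}\rangle$ and $\bar\eta^{\mathrm{dn}} = \langle \eta^{\mathrm{dn}}_\beta : \beta<\kappa_{\mathrm{dn}}\rangle$, be a $(\kappa_{\mathrm{up}},\kappa_{\mathrm{dn}})$-peculiar cut in ${}^\omega\omega$. Let $A \subseteq \omega$ be infinite and $\eta \in {}^\omega\omega$. Then: (a) $\eta <_{J^{\mathrm{bd}}_A} \eta^{\mathrm{up}}_\alpha$ for every $\alpha<\kappa_{\mathrm{up}}$ if and only if $\eta <_{J^{\mathrm{bd}}_A} \eta^{\mathrm{dn}}_\beta$ for every large enough $\beta<\kappa_{\mathrm{dn}}$; (b) $\neg(\eta^{\mathrm{up}}_\alpha <_{J^{\mathrm{bd}}_A} \eta)$ for every $\alpha<\kappa_{\mathrm{up}}$ if and only if $\neg(\eta^{\mathrm{dn}}_\beta <_{J^{\mathrm{bd}}_A} \eta)$ for every large enough $\beta<\kappa_{\mathrm{dn}}$.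
   Context: For $A\subseteq\omega$ infinite and $f,g\in{}^\omega\omega$, $f <_{J^{\mathrm{bd}}_A} g$ means $\{n\in A : f(n)\ge g(n)\}$ is finite, and $f \le_{J^{\mathrm{bd}}_A} g$ means $\{n\in A: f(n)>g(n)\}$ is finite; for $A=\omega$ these are written $<_{J^{\mathrm{bd}}_\omega}$, $\le_{J^{\mathrm{bd}}_\omega}$. For infinite regular $\kappa_1,\kappa_2$, a $(\kappa_1,\kappa_2)$-peculiar cut in ${}^\omega\omega$ is a pair $(\langle f_i : i<\kappa_1\rangle, \langle f^\alpha : \alpha<\kappa_2\rangle)$ of sequences in ${}^\omega\omega$ such that: ($\alpha$) $f_j <_{J^{\mathrm{bd}}_\omega} f_i$ for $i<j<\kappa_1$; ($\beta$) $f^\alpha <_{J^{\mathrm{bd}}_\omega} f^\beta$ for $\alpha<\beta<\kappa_2$; ($\gamma$) $f^\alpha <_{J^{\mathrm{bd}}_\omega} f_i$ for all $i,\alpha$; ($\delta$) if $f\in{}^\omega\omega$ and $f\le_{J^{\mathrm{bd}}_\omega} f_i$ for all $i<\kappa_1$ then $f\le_{J^{\mathrm{bd}}_\omega} f^\alpha$ for some $\alpha<\kappa_2$; ($\varepsilon$) if $f\in{}^\omega\omega$ and $f^\alpha\le_{J^{\mathrm{bd}}_\omega} f$ for all $\alpha<\kappa_2$ then $f_i\le_{J^{\mathrm{bd}}_\omega} f$ for some $i<\kappa_1$. Here $\bar\eta^{\mathrm{up}}$ plays the role of $\langle f_i\rangle$ and $\bar\eta^{\mathrm{dn}}$ of $\langle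 f^\alpha\rangle$. -}

module Defs where

open import Level using (0ℓ)
open import Data.Nat using (ℕ; _<_; _≤_; _>_; _≥_)
open import Data.Fin using (Fin)
open import Data.Unit using (⊤)
open import Data.List using (List)
open import Data.List.Membership.Propositional using (_∈_)
open import Data.Product using (Σ; _×_; ∃; _,_)
open import Data.Sum using (_⊎_)
open import Relation.Nullary using (¬_)
open import Relation.Binary.PropositionalEquality using (_≡_)
open import Relation.Binary.Definitions using (Trichotomous)
open import Relation.Binary.Structures using (IsStrictTotalOrder)
open import Induction.WellFounded using (WellFounded)
open import Function.Definitions using (Injective; Surjective)
open import Function.Bundles using (_⤖_)

Finite : (ℕ → Set) → Set
Finite P = Σ (List ℕ) λ xs → ∀ n → P n → n ∈ xs

Infinite : (ℕ → Set) → Set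
Infinite P = ¬ Finite P

_<[_]_ : (ℕ → ℕ) → (ℕ → Set) → (ℕ → ℕ) → Set
f <[ A ] g = Finite (λ n → A n × f n ≥ g n)

_≤[_]_ : (ℕ → ℕ) → (ℕ → Set) → (ℕ → ℕ) → Set
f ≤[ A ] g = Finite (λ n → A n × f n > g n)

ω : ℕ → Set
ω _ = ⊤

-- An infinite regular cardinal, presented as a well-ordered type
-- (a von Neumann ordinal up to isomorphism) which is
--  * an initial ordinal (not in bijection with any proper initial segment),
--  * infinite (no surjection from a finite set),
--  * regular (every cofinal subset has cardinality κ, i.e. κ injects into it).
record InfRegCard : Set₁ where
  field
    Carrier : Set
    _≺_ : Carrier → Carrier → Set
    isSTO : IsStrictTotalOrder _≡_ _≺_
    wf : WellFounded _≺_
    initial : ∀ a → ¬ (Carrier ⤖ Σ Carrier (λ x → x ≺ a))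
    infinite : ∀ n → ¬ (Σ (Fin n → Carrier) (Surjective _≡_ _≡_))
    regular : ∀ (X : Carrier → Set) →
              (∀ a → Σ Carrier λ b → X b × (a ≺ b ⊎ a ≡ b)) →
              Σ (Carrier → Σ Carrier X) (Injective _≡_ _≡_)
  _≼_ : Carrier → Carrier → Set
  a ≼ b = a ≺ b ⊎ a ≡ b
  Eventually : (Carrier → Set) → Set
  Eventually P = Σ Carrier λ b₀ → ∀ b → b₀ ≼ b → P b

record PeculiarCut (κ₁ κ₂ : InfRegCard) (up : InfRegCard.Carrier κ₁ → ℕ → ℕ)
                   (dn : InfRegCard.Carrier κ₂ → ℕ → ℕ) : Set where
  module K₁ = InfRegCard κ₁
  module K₂ = InfRegCard κ₂
  field
    α-clause : ∀ i j → i K₁.≺ j → up j <[ ω ] up i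
    β-clause : ∀ a b → a K₂.≺ b → dn a <[ ω ] dn b
    γ-clause : ∀ i a → dn a <[ ω ] up i
    δ-clause : ∀ f → (∀ i → f ≤[ ω ] up i) → Σ K₂.Carrier λ a → f ≤[ ω ] dn a
    ε-clause : ∀ f → (∀ a → dn a ≤[ ω ] f) → Σ K₁.Carrier λ i → up i ≤[ ω ] f

-- For (a), the function that is η + 1 on A
-- and 0 off A lies ≤ every ηup α exactly when η <_A ηup α for all α, so
-- clause (δ) puts it below some ηdn β; the monotonicity of ηdn then makes
-- η <_A ηdn β hold for all larger β.  For (b), if no ηdn β fails to be
-- <_A η, then the function that is η - 1 on A and some ηup α₀ off A bounds
-- every ηdn β, so clause (ε) yields an ηup α below it, hence ηup α <_A η.
-- The converse directions are transitivity through clause (γ).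
module Submission where

open import Defs
open import Level using (0ℓ)
open import Data.Nat using (ℕ; zero; suc; pred; _≤_; _<_; z≤n; s≤s; s≤s⁻¹)
open import Data.Nat.Properties using (≤-trans; ≤-total; <⇒≤)
open import Data.Product using (Σ; _×_; _,_)
open import Data.Sum using (inj₁; inj₂)
open import Data.Unit using (tt)
open import Data.Empty using (⊥-elim)
open import Data.List using ([]; _++_)
open import Data.List.Membership.Propositional.Properties using (∈-++⁺ˡ; ∈-++⁺ʳ)
open import Function using (_∘_)
open import Function.Bundles using (_⇔_; mk⇔; Equivalence)
open import Relation.Nullary using (¬_; yes; no)
open import Relation.Nullary.Decidable using (decidable-stable)
open import Relation.Unary using (Pred; _⊆_; _∪_; ∁)
open import Relation.Binary.PropositionalEquality using (refl)
open import Axiom.ExcludedMiddle using (ExcludedMiddle)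

finite-⊆ : {P Q : Pred ℕ 0ℓ} → Finite P → Q ⊆ P → Finite Q
finite-⊆ (xs , xs⊇P) Q⊆P = xs , λ n q → xs⊇P n (Q⊆P q)

finite-∪ : {P Q : Pred ℕ 0ℓ} → Finite P → Finite Q → Finite (P ∪ Q)
finite-∪ (xs , xs⊇P) (ys , ys⊇Q) = xs ++ ys , λ where
  n (inj₁ p) → ∈-++⁺ˡ (xs⊇P n p)
  n (inj₂ q) → ∈-++⁺ʳ xs (ys⊇Q n q)

module _ {A : Pred ℕ 0ℓ} where

  <[]-restrict : ∀ {B f g} → A ⊆ B → f <[ B ] g → f <[ A ] g
  <[]-restrict A⊆B f<g = finite-⊆ f<g λ (a , g≤f) → A⊆B a , g≤f

  <[]⇒≤[] : ∀ {f g} → f <[ A ] g → f ≤[ A ] g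
  <[]⇒≤[] f<g = finite-⊆ f<g λ (a , g<f) → a , <⇒≤ g<f

  <[]-trans : ∀ {f g h} → f <[ A ] g → g <[ A ] h → f <[ A ] h
  <[]-trans {f} {g} {h} f<g g<h = finite-⊆ (finite-∪ f<g g<h) split
    where
    split : (λ n → A n × h n ≤ f n) ⊆ (λ n → A n × g n ≤ f n) ∪ (λ n → A n × h n ≤ g n)
    split {n} (a , h≤f) with ≤-total (g n) (f n)
    ... | inj₁ g≤f = inj₁ (a , g≤f)
    ... | inj₂ f≤g = inj₂ (a , ≤-trans h≤f f≤g)

  <[]⇔suc≤[] : ∀ {f g} → f <[ A ] g ⇔ (suc ∘ f) ≤[ A ] g
  <[]⇔suc≤[] = mk⇔ (λ f<g → finite-⊆ f<g λ (a , sg≤sf) → a , s≤s⁻¹ sg≤sf)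
                   (λ sf≤g → finite-⊆ sf≤g λ (a , g≤f) → a , s≤s g≤f)

  <[]⇒≤[]pred : ∀ {f g} → f <[ A ] g → f ≤[ A ] (pred ∘ g)
  <[]⇒≤[]pred {f} {g} f<g = finite-⊆ f<g below
    where
    below : (λ n → A n × pred (g n) < f n) ⊆ (λ n → A n × g n ≤ f n)
    below {n} (a , pg<f) with g n
    ... | zero  = a , z≤n
    ... | suc _ = a , pg<f

  -- Where g vanishes on A, f ≤ pred ∘ g gives no strict bound; the witness
  -- h <_A g shows this happens only finitely often.
  ≤[]pred⇒<[] : ∀ {f g h} → h <[ A ] g → f ≤[ A ] (pred ∘ g) → f <[ A ] g
  ≤[]pred⇒<[] {f} {g} {h} h<g f≤pg = finite-⊆ (finite-∪ f≤pg h<g) split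
    where
    split : (λ n → A n × g n ≤ f n) ⊆ (λ n → A n × pred (g n) < f n) ∪ (λ n → A n × g n ≤ h n)
    split {n} (a , g≤f) with g n
    ... | zero  = inj₂ (a , z≤n)
    ... | suc _ = inj₁ (a , g≤f)

eventually-of-monotone : (κ : InfRegCard) {P : Pred (InfRegCard.Carrier κ) 0ℓ} →
  (∀ {a b} → InfRegCard._≺_ κ a b → P a → P b) →
  ∀ a → P a → InfRegCard.Eventually κ P
eventually-of-monotone κ mono a pa = a , λ where
  b (inj₁ a≺b) → mono a≺b pa
  .a (inj₂ refl) → pa

module Classical (em : ExcludedMiddle 0ℓ) where

  inhabited : (κ : InfRegCard) → InfRegCard.Carrier κ
  inhabited κ with em {InfRegCard.Carrier κ}
  ... | yes c = c
  ... | no ¬c = ⊥-elim (InfRegCard.infinite κ 0 ((λ ()) , λ c → ⊥-elim (¬c c)))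

  patch : Pred ℕ 0ℓ → (ℕ → ℕ) → (ℕ → ℕ) → ℕ → ℕ
  patch A p q n with em {A n}
  ... | yes _ = p n
  ... | no _  = q n

  module _ {A : Pred ℕ 0ℓ} {p q : ℕ → ℕ} where

    patch-≤[] : ∀ {f} → p ≤[ A ] f → q ≤[ ∁ A ] f → patch A p q ≤[ ω ] f
    patch-≤[] {f} p≤f q≤f = finite-⊆ (finite-∪ p≤f q≤f) split
      where
      split : (λ n → ω n × f n < patch A p q n) ⊆ (λ n → A n × f n < p n) ∪ (λ n → ∁ A n × f n < q n)
      split {n} (_ , f<pq) with em {A n}
      ... | yes a = inj₁ (a , f<pq)
      ... | no ¬a = inj₂ (¬a , f<pq)

    ≤[]-patch : ∀ {f} → f ≤[ A ] p → f ≤[ ∁ A ] q → f ≤[ ω ] patch A p q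
    ≤[]-patch {f} f≤p f≤q = finite-⊆ (finite-∪ f≤p f≤q) split
      where
      split : (λ n → ω n × patch A p q n < f n) ⊆ (λ n → A n × p n < f n) ∪ (λ n → ∁ A n × q n < f n)
      split {n} (_ , pq<f) with em {A n}
      ... | yes a = inj₁ (a , pq<f)
      ... | no ¬a = inj₂ (¬a , pq<f)

    patch-≤[]⇒ : ∀ {f} → patch A p q ≤[ ω ] f → p ≤[ A ] f
    patch-≤[]⇒ {f} pq≤f = finite-⊆ pq≤f onA
      where
      onA : (λ n → A n × f n < p n) ⊆ (λ n → ω n × f n < patch A p q n)
      onA {n} (a , f<p) with em {A n}
      ... | yes _ = tt , f<p
      ... | no ¬a = ⊥-elim (¬a a)

    ≤[]-patch⇒ : ∀ {f} → f ≤[ ω ] patch A p q → f ≤[ A ] p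
    ≤[]-patch⇒ {f} f≤pq = finite-⊆ f≤pq onA
      where
      onA : (λ n → A n × p n < f n) ⊆ (λ n → ω n × patch A p q n < f n)
      onA {n} (a , p<f) with em {A n}
      ... | yes _ = tt , p<f
      ... | no ¬a = ⊥-elim (¬a a)

module _ {κup κdn ηup ηdn} (cut : PeculiarCut κup κdn ηup ηdn)
         (A : Pred ℕ 0ℓ) (η : ℕ → ℕ) where

  open PeculiarCut cut

  dn<[]up : ∀ α β → ηdn β <[ A ] ηup α
  dn<[]up α β = <[]-restrict _ (γ-clause α β)

  below-dn-mono : ∀ {β β'} → β K₂.≺ β' → η <[ A ] ηdn β → η <[ A ] ηdn β'
  below-dn-mono β≺β' η<dn = <[]-trans η<dn (<[]-restrict _ (β-clause _ _ β≺β'))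

  not-above-dn-mono : ∀ {β β'} → β K₂.≺ β' → ¬ (ηdn β <[ A ] η) → ¬ (ηdn β' <[ A ] η)
  not-above-dn-mono β≺β' ¬dn<η dn'<η =
    ¬dn<η (<[]-trans (<[]-restrict _ (β-clause _ _ β≺β')) dn'<η)

  below-dn⇒below-up : K₂.Eventually (λ β → η <[ A ] ηdn β) → ∀ α → η <[ A ] ηup α
  below-dn⇒below-up (β , below) α = <[]-trans (below β (inj₂ refl)) (dn<[]up α β)

  not-above-dn⇒not-above-up : K₂.Eventually (λ β → ¬ (ηdn β <[ A ] η)) →
    ∀ α → ¬ (ηup α <[ A ] η)
  not-above-dn⇒not-above-up (β , not-above) α up<η =
    not-above β (inj₂ refl) (<[]-trans (dn<[]up α β) up<η)

  module _ (em : ExcludedMiddle 0ℓ) where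
    open Classical em

    below-up⇒below-dn : (∀ α → η <[ A ] ηup α) → K₂.Eventually (λ β → η <[ A ] ηdn β)
    below-up⇒below-dn below with δ-clause η⁺ η⁺≤up
      where
      η⁺ : ℕ → ℕ
      η⁺ = patch A (suc ∘ η) (λ _ → 0)
      η⁺≤up : ∀ α → η⁺ ≤[ ω ] ηup α
      η⁺≤up α = patch-≤[] (Equivalence.to <[]⇔suc≤[] (below α)) ([] , λ _ ())
    ... | β , η⁺≤dn = eventually-of-monotone κdn below-dn-mono β
                        (Equivalence.from <[]⇔suc≤[] (patch-≤[]⇒ η⁺≤dn))

    all-above-dn⇒some-up-above : (∀ β → ηdn β <[ A ] η) → Σ K₁.Carrier λ α → ηup α <[ A ] η
    all-above-dn⇒some-up-above dn<η with ε-clause η⁻ dn≤η⁻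
      where
      α₀ : K₁.Carrier
      α₀ = inhabited κup
      η⁻ : ℕ → ℕ
      η⁻ = patch A (pred ∘ η) (ηup α₀)
      dn≤η⁻ : ∀ β → ηdn β ≤[ ω ] η⁻
      dn≤η⁻ β = ≤[]-patch (<[]⇒≤[]pred (dn<η β)) (<[]⇒≤[] (<[]-restrict _ (γ-clause α₀ β)))
    ... | α , up≤η⁻ = α , ≤[]pred⇒<[] (dn<η (inhabited κdn)) (≤[]-patch⇒ up≤η⁻)

    not-above-up⇒not-above-dn : (∀ α → ¬ (ηup α <[ A ] η)) →
      K₂.Eventually (λ β → ¬ (ηdn β <[ A ] η))
    not-above-up⇒not-above-dn not-above with em {Σ K₂.Carrier λ β → ¬ (ηdn β <[ A ] η)}
    ... | yes (β , ¬dn<η) = eventually-of-monotone κdn not-above-dn-mono β ¬dn<η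
    ... | no none with all-above-dn⇒some-up-above
                         (λ β → decidable-stable em λ ¬dn<η → none (β , ¬dn<η))
    ...   | α , up<η = ⊥-elim (not-above α up<η)

mainTheorem2 : ExcludedMiddle 0ℓ →
    (κup κdn : InfRegCard) →
    (ηup : InfRegCard.Carrier κup → ℕ → ℕ) →
    (ηdn : InfRegCard.Carrier κdn → ℕ → ℕ) →
    PeculiarCut κup κdn ηup ηdn →
    (A : ℕ → Set) → Infinite A → (η : ℕ → ℕ) →
    ((∀ α → η <[ A ] ηup α)
    ⇔ InfRegCard.Eventually κdn (λ β → η <[ A ] ηdn β))
    × ((∀ α → ¬ (ηup α <[ A ] η))
    ⇔ InfRegCard.Eventually κdn (λ β → ¬ (ηdn β <[ A ] η)))
mainTheorem2 em κup κdn ηup ηdn cut A _ η =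
  mk⇔ (below-up⇒below-dn cut A η em) (below-dn⇒below-up cut A η) ,
  mk⇔ (not-above-up⇒not-above-dn cut A η em) (not-above-dn⇒not-above-up cut A η)
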